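{- Let $A$ be a set with decidable equality. Let $\mathrm{TMSLat}(A)$ be the set of total meet semilattice structures on $A$ and $\mathrm{Sort}(A)$ the set of sorting functions with carrier set $A$. There is a map $l2s\colon\mathrm{TMSLat}(A)\to\mathrm{Sort}(A)$ which is an equivalence.
   Context: Univalent type theory; "merely" means propositionally truncated. A total meet semilattice on $A$ is a binary operation $\wedge$ that is idempotent, associative, commutative, and total (for all $x,y$, merely $x\wedge y=x$ or $x\wedge y=y$). $L(A)$ is the free monoid on $A$ (finite lists, $x::xs$ prepending), $M(A)$ the free commutative monoid (finite multisets) with generators $\eta_A$, and $q\colon L(A)\to M(A)$ the monoid homomorphism extending $\eta_A$. A section is $s\colon M(A)\to L(A)$ with $q\circ s=\mathrm{id}$. $xs\in\mathrm{im}(s)$ means there merely exists $ys$ with $s(ys)=xs$; $y\in xs$ means $y$ equals some entry of $xs$. A sorting function is a section $s$ satisfying is-head-least (for all $x,y,xs$: $y\in x::xs$ and $x::xs\in\mathrm{im}(s)$ imply $[x,y]\in\mathrm{im}(s)$) and is-tail-sort (for all $x,xs$: $x::xs\in\mathrm{im}(s)$ implies $xs\in\mathrm{im}(s)$). -}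

module Defs where

open import Data.List using (List; []; _∷_)
open import Data.List.Membership.Propositional using (_∈_)
open import Data.List.Relation.Binary.Permutation.Propositional using (_↭_)
open import Data.Product using (Σ; ∃; _×_)
open import Data.Sum using (_⊎_)
open import Relation.Binary.PropositionalEquality using (_≡_)

record TMSLat (A : Set) : Set where
  field
    _∧_   : A → A → A
    idem  : ∀ x → x ∧ x ≡ x
    assoc : ∀ x y z → (x ∧ y) ∧ z ≡ x ∧ (y ∧ z)
    comm  : ∀ x y → x ∧ y ≡ y ∧ x
    total : ∀ x y → (x ∧ y ≡ x) ⊎ (x ∧ y ≡ y)

-- M(A), the free commutative monoid, is modelled as the setoid (List A, _↭_);
-- q : L(A) → M(A) is then the identity on lists.
-- A map s : M(A) → L(A) is a function on lists that respects _↭_.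
-- The section condition q ∘ s = id reads: s xs ↭ xs.

InImage : {A : Set} → (List A → List A) → List A → Set
InImage s xs = ∃ λ ys → s ys ≡ xs

record Sort (A : Set) : Set where
  field
    sort        : List A → List A
    sort-resp   : ∀ {xs ys} → xs ↭ ys → sort xs ≡ sort ys
    section     : ∀ xs → sort xs ↭ xs
    isHeadLeast : ∀ x y xs → y ∈ (x ∷ xs) → InImage sort (x ∷ xs)
                  → InImage sort (x ∷ y ∷ [])
    isTailSort  : ∀ x xs → InImage sort (x ∷ xs) → InImage sort xs

-- Equality of structures (pointwise on the underlying data; the remaining
-- fields are propositions in the paper's univalent setting).
_≈T_ : {A : Set} → TMSLat A → TMSLat A → Set
m ≈T m' = ∀ x y → TMSLat._∧_ m x y ≡ TMSLat._∧_ m' x y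

_≈S_ : {A : Set} → Sort A → Sort A → Set
σ ≈S σ' = ∀ xs → Sort.sort σ xs ≡ Sort.sort σ' xs

module Submission where

-- A total meet semilattice is a decidable total order (x ≤ y iff x ≡ x ∧ y), and any
-- sorting algorithm for it is a sorting function. Since sorted permutations are unique,
-- a section of q is determined by the fact that its image consists of sorted lists.
-- Conversely, a sorting function s gives x ∧ y := head of s [x , y]. By is-head-least
-- the head of any list in the image is least among its entries; applied to s [x , y , z]
-- this makes x ≲ y :⇔ x ∧ y ≡ x a total preorder with ∧ as its min operator, which gives
-- associativity. Both round trips then follow from uniqueness of sorted permutations.

open import Defs
open import Algebra.Construct.NaturalChoice.Base using (MinOperator)
import Algebra.Construct.NaturalChoice.MinOp as MinOp
open import Algebra.Lattice.Structures using (IsSemilattice)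
open import Data.Empty using (⊥-elim)
open import Data.List using (List; []; _∷_; head)
open import Data.List.Membership.Propositional using (_∈_)
open import Data.List.Relation.Binary.Permutation.Propositional
  using (_↭_; ↭-refl; ↭-sym; ↭-trans; swap; ↭⇒↭ₛ)
open import Data.List.Relation.Binary.Permutation.Propositional.Properties
  using (∈-resp-↭; ¬x∷xs↭[])
open import Data.List.Relation.Binary.Pointwise using (Pointwise-≡⇒≡)
open import Data.List.Relation.Unary.Any using (here; there)
open import Data.List.Relation.Unary.All using (lookup)
open import Data.List.Relation.Unary.Linked as Linked using (Linked; []; [-]; _∷_)
open import Data.List.Relation.Unary.Linked.Properties using (Linked⇒All)
import Data.List.Relation.Unary.Sorted.TotalOrder as SortedOver
open import Data.List.Relation.Unary.Sorted.TotalOrder.Properties using (↗↭↗⇒≋)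
import Data.List.Sort as ListSort
open import Data.Maybe using (just; fromMaybe)
open import Data.Product using (Σ; _×_; _,_)
open import Data.Sum using (_⊎_; inj₁; inj₂)
open import Function using (_∘_)
open import Level using (0ℓ)
open import Relation.Binary using (Rel; IsDecTotalOrder; DecTotalOrder; TotalPreorder)
open import Relation.Binary.Definitions using (DecidableEquality)
import Relation.Binary.Construct.NaturalOrder.Left as NaturalOrder
open import Relation.Binary.PropositionalEquality
  using (_≡_; _≢_; refl; sym; trans; cong; cong₂; subst; isEquivalence)

private
  variable
    A : Set

module Sorting {_≤_ : Rel A 0ℓ} (isDecTotalOrder : IsDecTotalOrder _≡_ _≤_) where

  order : DecTotalOrder 0ℓ 0ℓ 0ℓ
  order = record { isDecTotalOrder = isDecTotalOrder }

  open DecTotalOrder order using (totalOrder) renaming (refl to ≤-refl; trans to ≤-trans)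
  open SortedOver totalOrder public using (Sorted)
  open ListSort order public using (sort; sort-↭; sort-↗)

  sorted-unique : ∀ {xs ys} → Sorted xs → Sorted ys → xs ↭ ys → xs ≡ ys
  sorted-unique xs↗ ys↗ = Pointwise-≡⇒≡ ∘ ↗↭↗⇒≋ totalOrder xs↗ ys↗ ∘ ↭⇒↭ₛ

  sort-unique : ∀ {xs ys} → Sorted ys → ys ↭ xs → sort xs ≡ ys
  sort-unique {xs} ys↗ ys↭xs = sorted-unique (sort-↗ xs) ys↗ (↭-trans (sort-↭ xs) (↭-sym ys↭xs))

  sort-resp-↭ : ∀ {xs ys} → xs ↭ ys → sort xs ≡ sort ys
  sort-resp-↭ {xs} {ys} xs↭ys = sort-unique (sort-↗ ys) (↭-trans (sort-↭ ys) (↭-sym xs↭ys))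

  Sorted⇒InImage : ∀ {xs} → Sorted xs → InImage sort xs
  Sorted⇒InImage {xs} xs↗ = xs , sort-unique xs↗ ↭-refl

  InImage⇒Sorted : ∀ {xs} → InImage sort xs → Sorted xs
  InImage⇒Sorted (ys , refl) = sort-↗ ys

  head-least : ∀ {x y xs} → Sorted (x ∷ xs) → y ∈ x ∷ xs → x ≤ y
  head-least _               (here refl)  = ≤-refl
  head-least (x≤x′ ∷ x′∷xs↗) (there y∈xs) = lookup (Linked⇒All ≤-trans x≤x′ x′∷xs↗) y∈xs

  sortingFunction : Sort A
  sortingFunction = record
    { sort        = sort
    ; sort-resp   = sort-resp-↭
    ; section     = sort-↭
    ; isHeadLeast = λ _ _ _ y∈ im →
        Sorted⇒InImage (head-least (InImage⇒Sorted im) y∈ ∷ [-])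
    ; isTailSort  = λ _ _ → Sorted⇒InImage ∘ Linked.tail ∘ InImage⇒Sorted
    }

module FromTMSLat (m : TMSLat A) (_≟_ : DecidableEquality A) where
  open TMSLat m

  isSemilattice : IsSemilattice _≡_ _∧_
  isSemilattice = record
    { isBand = record
      { isSemigroup = record
        { isMagma = record { isEquivalence = isEquivalence ; ∙-cong = cong₂ _∧_ }
        ; assoc   = assoc
        }
      ; idem = idem
      }
    ; comm = comm
    }

  open Sorting (NaturalOrder.isDecTotalOrder _≡_ _∧_ isSemilattice total _≟_) public

  head-sort-pair : ∀ x y → head (sort (x ∷ y ∷ [])) ≡ just (x ∧ y)
  head-sort-pair x y with total x y
  ... | inj₁ x∧y≡x = trans (cong head (sort-unique (sym x∧y≡x ∷ [-]) ↭-refl)) (cong just (sym x∧y≡x))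
  ... | inj₂ x∧y≡y = trans (cong head (sort-unique (y≤x ∷ [-]) (swap y x ↭-refl))) (cong just (sym x∧y≡y))
    where
    y≤x : y ≡ y ∧ x
    y≤x = trans (sym x∧y≡y) (comm x y)

module FromSort (σ : Sort A) where
  open Sort σ

  -- The default x is never used, as sort (x ∷ y ∷ []) is nonempty.
  meet : A → A → A
  meet x y = fromMaybe x (head (sort (x ∷ y ∷ [])))

  sort-∷-nonempty : ∀ {x xs} → sort (x ∷ xs) ≢ []
  sort-∷-nonempty {x} {xs} eq = ¬x∷xs↭[] (↭-sym (subst (_↭ x ∷ xs) eq (section (x ∷ xs))))

  meet-∈ : ∀ x y → meet x y ∈ x ∷ y ∷ []
  meet-∈ x y with sort (x ∷ y ∷ []) in eq
  ... | []    = ⊥-elim (sort-∷-nonempty eq)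
  ... | _ ∷ _ = ∈-resp-↭ (subst (_↭ x ∷ y ∷ []) eq (section (x ∷ y ∷ []))) (here refl)

  meet-comm : ∀ x y → meet x y ≡ meet y x
  meet-comm x y = trans (cong (fromMaybe x ∘ head) (sort-resp (swap x y ↭-refl))) default-irrelevant
    where
    default-irrelevant : fromMaybe x (head (sort (y ∷ x ∷ []))) ≡ meet y x
    default-irrelevant with sort (y ∷ x ∷ []) in eq
    ... | []    = ⊥-elim (sort-∷-nonempty eq)
    ... | _ ∷ _ = refl

  meet-idem : ∀ x → meet x x ≡ x
  meet-idem x with meet-∈ x x
  ... | here eq         = eq
  ... | there (here eq) = eq

  meet-sel : ∀ x y → (meet x y ≡ x) ⊎ (meet x y ≡ y)
  meet-sel x y with meet-∈ x y
  ... | here eq         = inj₁ eq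
  ... | there (here eq) = inj₂ eq

  _≲_ : Rel A 0ℓ
  x ≲ y = meet x y ≡ x

  ≲-antisym : ∀ {x y} → x ≲ y → y ≲ x → x ≡ y
  ≲-antisym {x} {y} x≲y y≲x = trans (sym x≲y) (trans (meet-comm x y) y≲x)

  ≲-total : ∀ x y → (x ≲ y) ⊎ (y ≲ x)
  ≲-total x y with meet-sel x y
  ... | inj₁ eq = inj₁ eq
  ... | inj₂ eq = inj₂ (trans (meet-comm y x) eq)

  sort-fixes-image : ∀ {xs} → InImage sort xs → sort xs ≡ xs
  sort-fixes-image (ys , refl) = sort-resp (section ys)

  InImage-head-least : ∀ {h w t} → InImage sort (h ∷ t) → w ∈ h ∷ t → h ≲ w
  InImage-head-least {h} {w} {t} im w∈ =
    cong (fromMaybe h ∘ head) (sort-fixes-image (isHeadLeast h w t w∈ im))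

  sort-has-least : ∀ x xs → Σ A λ h → h ∈ x ∷ xs × (∀ {w} → w ∈ x ∷ xs → h ≲ w)
  sort-has-least x xs with sort (x ∷ xs) in eq
  ... | []    = ⊥-elim (sort-∷-nonempty eq)
  ... | h ∷ t = h , ∈-resp-↭ sort↭ (here refl) , InImage-head-least (x ∷ xs , eq) ∘ ∈-resp-↭ (↭-sym sort↭)
    where
    sort↭ : h ∷ t ↭ x ∷ xs
    sort↭ = subst (_↭ x ∷ xs) eq (section (x ∷ xs))

  ≲-trans : ∀ {x y z} → x ≲ y → y ≲ z → x ≲ z
  ≲-trans {x} {y} {z} x≲y y≲z with sort-has-least x (y ∷ z ∷ [])
  ... | _ , here refl                 , least = least (there (there (here refl)))
  ... | _ , there (here refl)         , least = subst (_≲ z) (sym (≲-antisym x≲y (least (here refl)))) y≲z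
  ... | _ , there (there (here refl)) , least = subst (x ≲_) (≲-antisym y≲z (least (there (here refl)))) x≲y

  totalPreorder : TotalPreorder 0ℓ 0ℓ 0ℓ
  totalPreorder = record
    { isTotalPreorder = record
      { isPreorder = record
        { isEquivalence = isEquivalence
        ; reflexive     = λ { {x} refl → meet-idem x }
        ; trans         = ≲-trans
        }
      ; total = ≲-total
      }
    }

  minOperator : MinOperator totalPreorder
  minOperator = record
    { _⊓_       = meet
    ; x≤y⇒x⊓y≈x = λ x≲y → x≲y
    ; x≥y⇒x⊓y≈y = λ {x} {y} y≲x → trans (meet-comm x y) y≲x
    }

  tmsLat : TMSLat A
  tmsLat = record
    { _∧_   = meet
    ; idem  = meet-idem
    ; assoc = MinOp.⊓-assoc minOperator
    ; comm  = meet-comm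
    ; total = meet-sel
    }

  -- Stated for the order x ≡ x ∧ y that FromTMSLat puts on tmsLat.
  InImage⇒Linked : ∀ {xs} → InImage sort xs → Linked (λ x y → x ≡ meet x y) xs
  InImage⇒Linked {[]}         _  = []
  InImage⇒Linked {_ ∷ []}     _  = [-]
  InImage⇒Linked {x ∷ y ∷ ys} im =
    sym (InImage-head-least im (there (here refl))) ∷ InImage⇒Linked (isTailSort x (y ∷ ys) im)

corollary73 : (A : Set) → DecidableEquality A →
    Σ (TMSLat A → Sort A) λ l2s →
    Σ (Sort A → TMSLat A) λ s2l →
      (∀ m m' → m ≈T m' → l2s m ≈S l2s m') ×
      (∀ σ σ' → σ ≈S σ' → s2l σ ≈T s2l σ') ×
      (∀ m → s2l (l2s m) ≈T m) ×
      (∀ σ → l2s (s2l σ) ≈S σ)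
corollary73 A _≟_ = l2s , s2l , l2s-cong , s2l-cong , s2l∘l2s , l2s∘s2l
  where
  l2s : TMSLat A → Sort A
  l2s m = FromTMSLat.sortingFunction m _≟_

  s2l : Sort A → TMSLat A
  s2l = FromSort.tmsLat

  l2s-cong : ∀ m m' → m ≈T m' → l2s m ≈S l2s m'
  l2s-cong m m' m≈m' xs = FromTMSLat.sort-unique m _≟_
    (Linked.map (λ {x} {y} x≤′y → trans x≤′y (sym (m≈m' x y))) (FromTMSLat.sort-↗ m' _≟_ xs))
    (FromTMSLat.sort-↭ m' _≟_ xs)

  s2l-cong : ∀ σ σ' → σ ≈S σ' → s2l σ ≈T s2l σ'
  s2l-cong σ σ' σ≈σ' x y = cong (fromMaybe x ∘ head) (σ≈σ' (x ∷ y ∷ []))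

  s2l∘l2s : ∀ m → s2l (l2s m) ≈T m
  s2l∘l2s m x y = cong (fromMaybe x) (FromTMSLat.head-sort-pair m _≟_ x y)

  l2s∘s2l : ∀ σ → l2s (s2l σ) ≈S σ
  l2s∘s2l σ xs = FromTMSLat.sort-unique (s2l σ) _≟_
    (FromSort.InImage⇒Linked σ (xs , refl)) (Sort.section σ xs)
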